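{- Let $(\Phi,\mathfrak N,\mathfrak T,\mathfrak R,\mathfrak S,\phi_{\mathrm{start}},\Sigma,\mathrm{Lex},\mathrm{Sel})$ be a parameterized local lexing, $D\in\Sigma^*$, $0\le k\le|D|$, $I$ a set of parameterized items and $I'$ a set of ordinary items of the induced grammar. If $I\sim I'$, then $\mathrm{Complete}\,k\,I\sim\mathrm{Complete}'\,k\,I'$.
   Context: $\Phi$ is a non-empty set; $\mathfrak N,\mathfrak T$ disjoint sets of nonterminals and terminals; $\mathfrak S\in\mathfrak N$, $\phi_{\mathrm{start}}\in\Phi$; $\mathfrak R$ a set of parameterized rules $N_{f_{k+1}}\to X_1^{f_1}\cdots X_k^{f_k}$ ($k\ge0$, $N\in\mathfrak N$, $X_i\in\mathfrak N\cup\mathfrak T$, partial $f_i:\Phi^{2i-1}\rightharpoonup\Phi$); $\Sigma,\mathrm{Lex},\mathrm{Sel}$ not needed here. Sequences indexed from 0; juxtaposition is concatenation; $\mathrm{take}_n$ takes the first $n$ entries. $\langle f_1,\dots,f_u\rangle$ is the set of $\rho\in\Phi^{2u}$ with $f_i$ defined at $(\rho_0,\dots,\rho_{2i-2})$ and $\rho_{2i-1}=f_i(\rho_0,\dots,\rho_{2i-2})$ for $i=1,\dots,u$. Induced grammar: nonterminals $(\mathfrak N\times\Phi\times\Phi)\cup\{\top,\bot\}$, terminals $\mathfrak T\times\Phi\times\Phi$, triples written $X^\alpha_\beta$; rules $\overline{\mathfrak R}=\{\top\to\mathfrak S^{\phi_{\mathrm{start}}}_\beta\mid\beta\in\Phi\}\cup\bigcup_{r\in\mathfrak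 R}\overline r$, where for $r=N_{f_{k+1}}\to X_1^{f_1}\cdots X_k^{f_k}$, $\overline r$ consists of (i) rules $N^\alpha_\beta\to(X_1)^{\alpha_1}_{\beta_1}\cdots(X_k)^{\alpha_k}_{\beta_k}$ with $(\alpha,\alpha_1,\beta_1,\dots,\alpha_k,\beta_k,\beta)\in\langle f_1,\dots,f_{k+1}\rangle$, and (ii) rules $N^\alpha_\beta\to(X_1)^{\alpha_1}_{\beta_1}\cdots(X_h)^{\alpha_h}_{\beta_h}\bot$ with $1\le h\le k$, $\beta,\beta_h\in\Phi$, $(\alpha,\alpha_1,\beta_1,\dots,\alpha_h)\in\langle f_1,\dots,f_h\rangle$ and $f_{h+1}$ undefined at $(\alpha,\alpha_1,\beta_1,\dots,\alpha_h,\beta_h)$. Items: parameterized item $(r,d,i,j,\rho)$ with $r=N_{f_{v+1}}\to X_1^{f_1}\cdots X_v^{f_v}\in\mathfrak R$, $0\le d\le v$, $0\le i\le j\le|D|$, $\rho\in\langle f_1,\dots,f_{d+1}\rangle$. Ordinary item $(q,d,i,j)$ with $q=(L\to w)\in\overline{\mathfrak R}$, $0\le d\le|w|$, $0\le i\le j\le|D|$, written $(L\to w_1\bullet w_2,i,j)$, $|w_1|=d$. For $x=(r,d,i,j,\rho)$, $\overline x$ consists of all $(q,d,i,j)$ with $q\in\overline r$ of type (i) and $\mathrm{take}_{2(d+1)}(\alpha,\alpha_1,\beta_1,\dots,\alpha_k,\beta_k,\beta)=\rho$, and all $(q,d,i,j)$ with $q\in\overline r$ of type (ii), $d\le h-1$,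 $\mathrm{take}_{2(d+1)}(\alpha,\alpha_1,\beta_1,\dots,\alpha_h)=\rho$. $\overline I=\bigcup_{x\in I}\overline x$; $\mathrm{Norm}(I')=\{(L\to w_1\bullet w_2,i,j)\in I'\mid L\ne\top,\ w_2\text{ is not the one-symbol string }\bot\}$; $I\sim I'$ means $\overline I=\mathrm{Norm}(I')$. $\mathrm{Complete}\,k\,I=I\cup\{(r,d+1,i,k,\rho'\,f_{d+2}(\rho'))\mid(r,d,i,j,\rho)\in I$ with $r=N_{f_{v+1}}\to X_1^{f_1}\cdots X_v^{f_v}$, $d<v$, $X_{d+1}=M$; $(r',u,j,k,\xi)\in I$ with $r'=M_{g_{u+1}}\to Y_1^{g_1}\cdots Y_u^{g_u}$; $\rho_{2d+1}=\xi_0$; $\rho'=\rho\,\xi_{2u+1}$; $f_{d+2}$ defined at $\rho'\}$. $\mathrm{Complete}'\,k\,I'=I'\cup\{(L\to a\,M\bullet b,i,k)\mid(L\to a\bullet M\,b,i,j)\in I',\ (M\to w\bullet,j,k)\in I'\}$. -}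

module Defs where

open import Level using (0ℓ)
open import Data.Nat using (ℕ; zero; suc; _+_; _*_; _≤_; _<_)
open import Data.Fin using (Fin; toℕ)
open import Data.List using (List; []; _∷_; _++_; [_]; length; take; drop)
open import Data.Vec using (Vec; toList)
open import Data.Maybe using (Maybe; just; nothing)
open import Data.Product using (Σ; ∃; _×_; _,_; proj₁; proj₂)
open import Data.Sum using (_⊎_; inj₁; inj₂)
open import Relation.Binary.PropositionalEquality using (_≡_; _≢_)
open import Relation.Unary using (Pred; _∈_; _≐_)

PFun : Set → ℕ → Set
PFun Φ n = Vec Φ n → Maybe Φ

-- A parameterized rule  N_{f_{k+1}} → X_1^{f_1} ⋯ X_k^{f_k}.
-- rhs = X_1 ⋯ X_k (k = length rhs); fs i is f_{i+1} : Φ^{2i+1} ⇀ Φ, for i = 0 … k.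
-- Symbols are 𝔑 ⊎ 𝔗 (so 𝔑, 𝔗 are disjoint by construction).
record PRule (Φ 𝔑 𝔗 : Set) : Set where
  constructor prule
  field
    lhs : 𝔑
    rhs : List (𝔑 ⊎ 𝔗)
    fs  : (i : Fin (suc (length rhs))) → PFun Φ (suc (2 * toℕ i))

-- The data of a parameterized local lexing used by the statement.
-- (Lex and Sel are not needed; Φ is non-empty as witnessed by φstart.)
record PLL : Set₁ where
  field
    Φ      : Set
    𝔑      : Set
    𝔗      : Set
    Alph   : Set
    ℜ      : Pred (PRule Φ 𝔑 𝔗) 0ℓ
    𝔖      : 𝔑
    φstart : Φ

_!?_ : {A : Set} → List A → ℕ → Maybe A
[]       !? _     = nothing
(x ∷ xs) !? zero  = just x
(x ∷ xs) !? suc n = xs !? n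

module Induced (G : PLL) where
  open PLL G public

  Rule : Set
  Rule = PRule Φ 𝔑 𝔗

  open PRule public

  DefAt : {n : ℕ} → PFun Φ n → List Φ → Φ → Set
  DefAt {n} f xs y = Σ (Vec Φ n) λ v → toList v ≡ xs × f v ≡ just y

  UndefAt : {n : ℕ} → PFun Φ n → List Φ → Set
  UndefAt {n} f xs = Σ (Vec Φ n) λ v → toList v ≡ xs × f v ≡ nothing

  -- ρ ∈ ⟨f_1,…,f_u⟩ for the functions of rule r  (u ≤ length (rhs r) + 1)
  InB : Rule → ℕ → List Φ → Set
  InB r u ρ =
    length ρ ≡ 2 * u ×
    ((i : Fin (suc (length (rhs r)))) → toℕ i < u →
      Σ Φ λ y → take (2 + 2 * toℕ i) ρ ≡ take (1 + 2 * toℕ i) ρ ++ [ y ]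
              × DefAt (fs r i) (take (1 + 2 * toℕ i) ρ) y)

  data INT : Set where
    nt : 𝔑 → Φ → Φ → INT
    ⊤ₙ : INT
    ⊥ₙ : INT

  data ISym : Set where
    nonterm : INT → ISym
    term    : 𝔗 → Φ → Φ → ISym

  liftSym : 𝔑 ⊎ 𝔗 → Φ → Φ → ISym
  liftSym (inj₁ N) α β = nonterm (nt N α β)
  liftSym (inj₂ a) α β = term a α β

  liftAll : List (𝔑 ⊎ 𝔗) → List (Φ × Φ) → List ISym
  liftAll (X ∷ Xs) ((a , b) ∷ ab) = liftSym X a b ∷ liftAll Xs ab
  liftAll _ _ = []

  flatten : List (Φ × Φ) → List Φ
  flatten [] = []
  flatten ((a , b) ∷ ab) = a ∷ b ∷ flatten ab

  IRule : Set
  IRule = INT × List ISym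

  -- q ∈ r̄ of type (i), with full parameter sequence seq = (α, α_1, β_1, …, α_k, β_k, β)
  record BarI (r : Rule) (q : IRule) (seq : List Φ) : Set where
    field
      α β   : Φ
      ab    : List (Φ × Φ)
      len   : length ab ≡ length (rhs r)
      seqEq : seq ≡ α ∷ flatten ab ++ [ β ]
      inB   : InB r (suc (length (rhs r))) seq
      qEq   : q ≡ (nt (lhs r) α β , liftAll (rhs r) ab)

  -- q ∈ r̄ of type (ii) with cut position h, and pre = (α, α_1, β_1, …, α_h)
  record BarII (r : Rule) (q : IRule) (h : ℕ) (pre : List Φ) : Set where
    field
      α β    : Φ
      ab     : List (Φ × Φ)
      h≥1    : 1 ≤ h
      h≤k    : h ≤ length (rhs r)
      len    : length ab ≡ h
      preEq  : pre ≡ take (2 * h) (α ∷ flatten ab)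
      inB    : InB r h pre
      undef  : Σ (Fin (suc (length (rhs r)))) λ i →
                 toℕ i ≡ h × UndefAt (fs r i) (α ∷ flatten ab)
      qEq    : q ≡ (nt (lhs r) α β , liftAll (take h (rhs r)) ab ++ [ nonterm ⊥ₙ ])

  InRBar : Rule → IRule → Set
  InRBar r q = (Σ (List Φ) λ seq → BarI r q seq) ⊎ (Σ ℕ λ h → Σ (List Φ) λ pre → BarII r q h pre)

  InℜBar : IRule → Set
  InℜBar q = (Σ Φ λ β → q ≡ (⊤ₙ , [ nonterm (nt 𝔖 φstart β) ]))
           ⊎ (Σ Rule λ r → r ∈ ℜ × InRBar r q)

  record PItem : Set where
    constructor pitem
    field
      rule : Rule
      dot  : ℕ
      i j  : ℕ
      ρ    : List Φ

  record OItem : Set where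
    constructor oitem
    field
      rule : IRule
      dot  : ℕ
      i j  : ℕ

  ValidP : ℕ → PItem → Set
  ValidP n (pitem r d i j ρ) = r ∈ ℜ × d ≤ length (rhs r) × i ≤ j × j ≤ n × InB r (suc d) ρ

  ValidO : ℕ → OItem → Set
  ValidO n (oitem q d i j) = InℜBar q × d ≤ length (proj₂ q) × i ≤ j × j ≤ n

  InBar : PItem → OItem → Set
  InBar (pitem r d i j ρ) (oitem q d' i' j') =
    d' ≡ d × i' ≡ i × j' ≡ j ×
    ((Σ (List Φ) λ seq → BarI r q seq × take (2 * suc d) seq ≡ ρ)
     ⊎ (Σ ℕ λ h → Σ (List Φ) λ pre → BarII r q h pre × suc d ≤ h × take (2 * suc d) pre ≡ ρ))

  BarSet : Pred PItem 0ℓ → Pred OItem 0ℓ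
  BarSet I y = Σ PItem λ x → x ∈ I × InBar x y

  Norm : Pred OItem 0ℓ → Pred OItem 0ℓ
  Norm I' y = y ∈ I' × proj₁ (OItem.rule y) ≢ ⊤ₙ
            × drop (OItem.dot y) (proj₂ (OItem.rule y)) ≢ [ nonterm ⊥ₙ ]

  _∼_ : Pred PItem 0ℓ → Pred OItem 0ℓ → Set
  I ∼ I' = BarSet I ≐ Norm I'

  CompleteStep : ℕ → Pred PItem 0ℓ → Pred PItem 0ℓ
  CompleteStep k I y =
    Σ PItem λ x → Σ PItem λ x' → x ∈ I × x' ∈ I ×
    let r = PItem.rule x ; d = PItem.dot x ; ρ = PItem.ρ x
        r' = PItem.rule x' ; u = PItem.dot x' ; ξ = PItem.ρ x' in
    Σ 𝔑 λ M →
      d < length (rhs r) × (rhs r !? d) ≡ just (inj₁ M) ×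
      lhs r' ≡ M × u ≡ length (rhs r') ×
      PItem.i x' ≡ PItem.j x × PItem.j x' ≡ k ×
      (Σ Φ λ a → (ρ !? (1 + 2 * d)) ≡ just a × (ξ !? 0) ≡ just a) ×
      Σ Φ λ b → (ξ !? (1 + 2 * u)) ≡ just b ×
      Σ Φ λ z → (Σ (Fin (suc (length (rhs r)))) λ e → toℕ e ≡ suc d × DefAt (fs r e) (ρ ++ [ b ]) z) ×
      y ≡ pitem r (suc d) (PItem.i x) k (ρ ++ [ b ] ++ [ z ])

  Complete : ℕ → Pred PItem 0ℓ → Pred PItem 0ℓ
  Complete k I y = y ∈ I ⊎ CompleteStep k I y

  CompleteStep' : ℕ → Pred OItem 0ℓ → Pred OItem 0ℓ
  CompleteStep' k I' y =
    Σ OItem λ y₁ → Σ OItem λ y₂ → y₁ ∈ I' × y₂ ∈ I' ×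
    Σ INT λ M →
      (proj₂ (OItem.rule y₁) !? OItem.dot y₁) ≡ just (nonterm M) ×
      proj₁ (OItem.rule y₂) ≡ M ×
      OItem.dot y₂ ≡ length (proj₂ (OItem.rule y₂)) ×
      OItem.i y₂ ≡ OItem.j y₁ × OItem.j y₂ ≡ k ×
      y ≡ oitem (OItem.rule y₁) (suc (OItem.dot y₁)) (OItem.i y₁) k

  Complete' : ℕ → Pred OItem 0ℓ → Pred OItem 0ℓ
  Complete' k I' y = y ∈ I' ⊎ CompleteStep' k I' y

-- An ordinary item (q , d) lies in x̄ for x = (r , d , i , j , ρ) exactly when the parameters
-- (α , α₁ , β₁ , …) of q agree with ρ on the first 2(d+1) entries, so the symbol after the dot
-- is (X_{d+1})^{ρ_{2d+1}}_β for some β. Moving the dot of q over it is therefore the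
-- same as extending ρ by β and α_{d+2} = f_{d+2}(ρ β), and the completed items it can be combined
-- with are exactly the type (i) rules M^{ξ₀}_{ξ_{2u+1}} → ⋯ in the bar of a completed (r′ , u , ξ).
-- Type (ii) rules never occur completed in a bar, where their dot stays left of X_h.
module Submission where

open import Defs
open import Level using (0ℓ)
open import Data.Nat using (ℕ; zero; suc; _+_; _*_; _⊓_; _≤_; _<_; z≤n; s≤s)
open import Data.Nat.Properties
  using (+-suc; +-comm; ≤-refl; ≤-trans; ≤-reflexive; n<1+n; n≤1+n; m<n⇒m<1+n; <⇒≤; suc-injective;
         *-monoʳ-≤; *-monoʳ-<; m≤n⇒m<n∨m≡n; m≤n⇒m⊓n≡m; 1+n≰n; module ≤-Reasoning)
open import Data.Fin using (Fin; toℕ; fromℕ<)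
open import Data.Fin.Properties using (toℕ-fromℕ<)
open import Data.List using (List; []; _∷_; _++_; [_]; length; take; drop)
open import Data.List.Properties
  using (++-assoc; length-++; length-take; take-take; take-all; drop-all; ∷-injectiveˡ)
open import Data.Maybe using (just)
open import Data.Product using (Σ; _×_; _,_; proj₁; proj₂; map₁; map₂)
open import Data.Sum using (_⊎_; inj₁; inj₂)
open import Data.Empty using (⊥-elim)
open import Relation.Unary using (Pred; _∈_; _⊆_)
open import Relation.Binary.PropositionalEquality
  using (_≡_; _≢_; refl; sym; trans; cong; subst; module ≡-Reasoning)

module _ {A : Set} where

  !?-take : ∀ {n m} (xs : List A) → n < m → take m xs !? n ≡ xs !? n
  !?-take {m = zero}          []       _        = refl
  !?-take {m = suc m}         []       _        = refl
  !?-take {zero}  {suc m}     (x ∷ xs) _        = refl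
  !?-take {suc n} {suc m}     (x ∷ xs) (s≤s lt) = !?-take xs lt

  !?-prefix : ∀ {n m} {xs ys : List A} → take m xs ≡ ys → n < m → ys !? n ≡ xs !? n
  !?-prefix {n} {xs = xs} refl lt = !?-take xs lt

  !?-take-just⁻ : ∀ {h n x} (xs : List A) → take h xs !? n ≡ just x → xs !? n ≡ just x
  !?-take-just⁻ {suc h} {zero}  (y ∷ xs) e = e
  !?-take-just⁻ {suc h} {suc n} (y ∷ xs) e = !?-take-just⁻ {h} xs e

  !?-just⇒< : ∀ {n x} (xs : List A) → xs !? n ≡ just x → n < length xs
  !?-just⇒< {zero}  (y ∷ xs) e = s≤s z≤n
  !?-just⇒< {suc n} (y ∷ xs) e = s≤s (!?-just⇒< xs e)

  !?-++ˡ : ∀ {n} (xs ys : List A) → n < length xs → (xs ++ ys) !? n ≡ xs !? n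
  !?-++ˡ {zero}  (x ∷ xs) ys _        = refl
  !?-++ˡ {suc n} (x ∷ xs) ys (s≤s lt) = !?-++ˡ xs ys lt

  !?-++ˡ-just : ∀ {n x} (xs ys : List A) → xs !? n ≡ just x → (xs ++ ys) !? n ≡ just x
  !?-++ˡ-just xs ys e = trans (!?-++ˡ xs ys (!?-just⇒< xs e)) e

  !?-++ˡ-just⁻ : ∀ {n x} (xs ys : List A) → n < length xs → (xs ++ ys) !? n ≡ just x → xs !? n ≡ just x
  !?-++ˡ-just⁻ xs ys lt e = trans (sym (!?-++ˡ xs ys lt)) e

  !?-length : ∀ {n} (xs : List A) x ys → length xs ≡ n → (xs ++ x ∷ ys) !? n ≡ just x
  !?-length []       x ys refl = refl
  !?-length (y ∷ xs) x ys refl = !?-length xs x ys refl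

  []≢[-] : ∀ {x : A} → [] ≢ [ x ]
  []≢[-] ()

  drop≡∷⇒!? : ∀ {n x ys} (xs : List A) → drop n xs ≡ x ∷ ys → xs !? n ≡ just x
  drop≡∷⇒!? {zero}  (y ∷ xs) refl = refl
  drop≡∷⇒!? {suc n} (y ∷ xs) e    = drop≡∷⇒!? xs e

  take-suc-!? : ∀ {n x} (xs : List A) → xs !? n ≡ just x → take (suc n) xs ≡ take n xs ++ [ x ]
  take-suc-!? {zero}  (y ∷ xs) refl = refl
  take-suc-!? {suc n} (y ∷ xs) e    = cong (y ∷_) (take-suc-!? xs e)

  take-length-++ : ∀ {n} (xs ys : List A) → length xs ≡ n → take n (xs ++ ys) ≡ xs
  take-length-++ []       ys refl = refl
  take-length-++ (x ∷ xs) ys refl = cong (x ∷_) (take-length-++ xs ys refl)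

  take-prefix : ∀ {n m} (xs ys zs : List A) → n ≤ m → length ys ≡ n → take m xs ≡ ys ++ zs → take n xs ≡ ys
  take-prefix {n} {m} xs ys zs n≤m |ys| tk = begin
    take n xs             ≡⟨ cong (λ l → take l xs) (sym (m≤n⇒m⊓n≡m n≤m)) ⟩
    take (n ⊓ m) xs       ≡⟨ sym (take-take n m xs) ⟩
    take n (take m xs)    ≡⟨ cong (take n) tk ⟩
    take n (ys ++ zs)     ≡⟨ take-length-++ ys zs |ys| ⟩
    ys                    ∎
    where open ≡-Reasoning

  drop-length-++ : ∀ (xs ys : List A) → drop (length xs) (xs ++ ys) ≡ ys
  drop-length-++ []       ys = refl
  drop-length-++ (x ∷ xs) ys = drop-length-++ xs ys

  drop-<-∷ʳ≢[-] : ∀ {n x y} (xs : List A) → n < length xs → drop n (xs ++ [ x ]) ≢ [ y ]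
  drop-<-∷ʳ≢[-] {zero}  (z ∷ [])     _        ()
  drop-<-∷ʳ≢[-] {zero}  (z ∷ w ∷ xs) _        ()
  drop-<-∷ʳ≢[-] {suc n} (z ∷ xs)     (s≤s lt) e = drop-<-∷ʳ≢[-] xs lt e

2*-suc : ∀ n → 2 * suc n ≡ 2 + 2 * n
2*-suc n = cong suc (+-suc n (n + 0))

1+2*m<2*n : ∀ {m n} → m < n → 1 + 2 * m < 2 * n
1+2*m<2*n {m} {n} m<n = begin-strict
  1 + 2 * m  <⟨ n<1+n _ ⟩
  2 + 2 * m  ≡⟨ sym (2*-suc m) ⟩
  2 * suc m  ≤⟨ *-monoʳ-≤ 2 m<n ⟩
  2 * n      ∎
  where open ≤-Reasoning

2+2*m<2*n : ∀ {m n} → suc m < n → 2 + 2 * m < 2 * n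
2+2*m<2*n {m} {n} m<n = subst (_< 2 * n) (2*-suc m) (*-monoʳ-< 2 m<n)

params-retreat : ∀ {A : Set} {d a b z} (L ρ : List A) → take (2 * suc (suc d)) L ≡ ρ ++ [ b ] ++ [ z ] →
  length ρ ≡ 2 * suc d → ρ !? (1 + 2 * d) ≡ just a →
  take (2 * suc d) L ≡ ρ × L !? (1 + 2 * d) ≡ just a × L !? (2 + 2 * d) ≡ just b
params-retreat {d = d} {b = b} {z} L ρ tk |ρ| ρ-a =
  take-prefix L ρ _ (*-monoʳ-≤ 2 (n≤1+n (suc d))) |ρ| tk ,
  trans (sym (!?-prefix tk (1+2*m<2*n (m<n⇒m<1+n (n<1+n d)))))
        (trans (!?-++ˡ ρ _ (subst (_ <_) (sym |ρ|) (1+2*m<2*n (n<1+n d)))) ρ-a) ,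
  trans (sym (!?-prefix tk (2+2*m<2*n (n<1+n (suc d))))) (!?-length ρ b [ z ] (trans |ρ| (2*-suc d)))

module _ (G : PLL) where
  open Induced G

  length-liftAll : ∀ (Xs : List (𝔑 ⊎ 𝔗)) ab → length ab ≡ length Xs → length (liftAll Xs ab) ≡ length Xs
  length-liftAll []       []              _ = refl
  length-liftAll (X ∷ Xs) ((a , b) ∷ ab) e = cong suc (length-liftAll Xs ab (suc-injective e))

  liftAll-!? : ∀ (Xs : List (𝔑 ⊎ 𝔗)) ab {d X a b} → Xs !? d ≡ just X → ab !? d ≡ just (a , b) →
               liftAll Xs ab !? d ≡ just (liftSym X a b)
  liftAll-!? (X ∷ Xs) ((a , b) ∷ ab) {zero}  refl refl = refl
  liftAll-!? (X ∷ Xs) ((a , b) ∷ ab) {suc d} eX   eab  = liftAll-!? Xs ab eX eab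

  liftAll-!?-nonterm : ∀ (Xs : List (𝔑 ⊎ 𝔗)) ab {d M} → liftAll Xs ab !? d ≡ just (nonterm M) →
    Σ 𝔑 λ N → Σ Φ λ a → Σ Φ λ b → Xs !? d ≡ just (inj₁ N) × ab !? d ≡ just (a , b) × M ≡ nt N a b
  liftAll-!?-nonterm (inj₁ N ∷ Xs) ((a , b) ∷ ab) {zero}  refl = N , a , b , refl , refl , refl
  liftAll-!?-nonterm (inj₂ t ∷ Xs) ((a , b) ∷ ab) {zero}  ()
  liftAll-!?-nonterm (X ∷ Xs)      (_ ∷ ab)       {suc d} e    = liftAll-!?-nonterm Xs ab e

  just-nonterm-injective : ∀ {M M′} → just (nonterm M) ≡ just (nonterm M′) → M ≡ M′
  just-nonterm-injective refl = refl

  liftSym≢⊥ : ∀ (X : 𝔑 ⊎ 𝔗) a b → liftSym X a b ≢ nonterm ⊥ₙ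
  liftSym≢⊥ (inj₁ N) a b ()
  liftSym≢⊥ (inj₂ t) a b ()

  drop-liftAll≢[⊥] : ∀ n (Xs : List (𝔑 ⊎ 𝔗)) ab → drop n (liftAll Xs ab) ≢ [ nonterm ⊥ₙ ]
  drop-liftAll≢[⊥] zero    (X ∷ Xs) ((a , b) ∷ ab) e = liftSym≢⊥ X a b (∷-injectiveˡ e)
  drop-liftAll≢[⊥] (suc n) (X ∷ Xs) ((a , b) ∷ ab) e = drop-liftAll≢[⊥] n Xs ab e
  drop-liftAll≢[⊥] zero    []       _              ()
  drop-liftAll≢[⊥] zero    (X ∷ Xs) []             ()
  drop-liftAll≢[⊥] (suc n) []       _              ()
  drop-liftAll≢[⊥] (suc n) (X ∷ Xs) []             ()

  length-flatten : ∀ (ab : List (Φ × Φ)) → length (flatten ab) ≡ 2 * length ab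
  length-flatten []             = refl
  length-flatten ((a , b) ∷ ab) = trans (cong (λ n → 2 + n) (length-flatten ab)) (sym (2*-suc (length ab)))

  flatten-!? : ∀ (ab : List (Φ × Φ)) {d a b} → ab !? d ≡ just (a , b) →
    flatten ab !? (2 * d) ≡ just a × flatten ab !? (1 + 2 * d) ≡ just b
  flatten-!? ((a , b) ∷ ab) {zero}  refl = refl , refl
  flatten-!? (_ ∷ ab)       {suc d} e rewrite +-suc d (d + 0) = flatten-!? ab e

  flatten-!?⁻ : ∀ (ab : List (Φ × Φ)) {d a b} → d < length ab →
    flatten ab !? (2 * d) ≡ just a → flatten ab !? (1 + 2 * d) ≡ just b → ab !? d ≡ just (a , b)
  flatten-!?⁻ ((a , b) ∷ ab) {zero}  _        refl refl = refl
  flatten-!?⁻ (_ ∷ ab)       {suc d} (s≤s lt) ea   eb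
    rewrite +-suc d (d + 0) = flatten-!?⁻ ab lt ea eb

  unflatten : ∀ n (xs : List Φ) → length xs ≡ 1 + 2 * n →
    Σ (List (Φ × Φ)) λ ab → Σ Φ λ β → length ab ≡ n × xs ≡ flatten ab ++ [ β ]
  unflatten zero    (β ∷ [])      _ = [] , β , refl , refl
  unflatten (suc n) (a ∷ b ∷ xs) e
    with unflatten n xs (suc-injective (suc-injective (trans e (cong suc (2*-suc n)))))
  ... | ab , β , refl , refl = (a , b) ∷ ab , β , refl , refl

  InℜBar⇒lhs≢⊥ : ∀ {q} → InℜBar q → proj₁ q ≢ ⊥ₙ
  InℜBar⇒lhs≢⊥ (inj₁ (β , refl)) ()
  InℜBar⇒lhs≢⊥ (inj₂ (r , _ , inj₁ (_ , record { qEq = refl }))) ()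
  InℜBar⇒lhs≢⊥ (inj₂ (r , _ , inj₂ (_ , _ , record { qEq = refl }))) ()

  Instance : Rule → ℕ → List Φ → IRule → Set
  Instance r d ρ q = (Σ (List Φ) λ seq → BarI r q seq × take (2 * suc d) seq ≡ ρ)
                   ⊎ (Σ ℕ λ h → Σ (List Φ) λ pre → BarII r q h pre × suc d ≤ h × take (2 * suc d) pre ≡ ρ)

  Instance⇒lhs≢⊤ : ∀ {r d ρ q} → Instance r d ρ q → proj₁ q ≢ ⊤ₙ
  Instance⇒lhs≢⊤ (inj₁ (_ , record { qEq = refl } , _))     ()
  Instance⇒lhs≢⊤ (inj₂ (_ , _ , record { qEq = refl } , _)) ()

  ParamDefAt : Rule → ℕ → List Φ → Φ → Set
  ParamDefAt r n xs z = Σ (Fin (suc (length (rhs r)))) λ e → toℕ e ≡ n × DefAt (fs r e) xs z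

  InB-extend : ∀ {r u n b ρ} (L : List Φ) → InB r u L →
    (e : Fin (suc (length (rhs r)))) → toℕ e ≡ n → n < u →
    take (2 * n) L ≡ ρ → L !? (2 * n) ≡ just b →
    Σ Φ λ z → DefAt (fs r e) (ρ ++ [ b ]) z × take (2 * suc n) L ≡ ρ ++ [ b ] ++ [ z ]
  InB-extend {r} {n = n} {b} {ρ} L (_ , entries) e refl n<u tk Lb with entries e n<u
  ... | z , step , def = z , subst (λ xs → DefAt (fs r e) xs z) ρb def , (begin
      take (2 * suc n) L              ≡⟨ cong (λ m → take m L) (2*-suc n) ⟩
      take (2 + 2 * n) L              ≡⟨ step ⟩
      take (1 + 2 * n) L ++ [ z ]     ≡⟨ cong (_++ [ z ]) ρb ⟩
      (ρ ++ [ b ]) ++ [ z ]           ≡⟨ ++-assoc ρ [ b ] [ z ] ⟩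
      ρ ++ [ b ] ++ [ z ]             ∎)
    where
      open ≡-Reasoning
      ρb : take (1 + 2 * n) L ≡ ρ ++ [ b ]
      ρb = trans (take-suc-!? L Lb) (cong (_++ [ b ]) tk)

  InB-advance : ∀ {r u d b ρ} (L : List Φ) → InB r u L → d < length (rhs r) → suc d < u →
    take (2 * suc d) L ≡ ρ → L !? (2 * suc d) ≡ just b →
    Σ Φ λ z → ParamDefAt r (suc d) (ρ ++ [ b ]) z × take (2 * suc (suc d)) L ≡ ρ ++ [ b ] ++ [ z ]
  InB-advance {r} L inB d<k sd<u tk Lb =
    let z , def , tk′ = InB-extend {r} L inB (fromℕ< (s≤s d<k)) (toℕ-fromℕ< (s≤s d<k)) sd<u tk Lb
    in  z , (fromℕ< (s≤s d<k) , toℕ-fromℕ< (s≤s d<k) , def) , tk′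

  length-liftAll-take : ∀ (Xs : List (𝔑 ⊎ 𝔗)) ab {h} → h ≤ length Xs → length ab ≡ h →
    length (liftAll (take h Xs) ab) ≡ h
  length-liftAll-take Xs ab {h} h≤k refl =
    trans (length-liftAll (take h Xs) ab (sym |take|)) |take|
    where |take| = trans (length-take h Xs) (m≤n⇒m⊓n≡m h≤k)

  BarII-length : ∀ {r q h pre} → BarII r q h pre → length (proj₂ q) ≡ suc h
  BarII-length {r} {h = h} record { ab = ab ; h≤k = h≤k ; len = len ; qEq = refl } =
    trans (length-++ (liftAll (take h (rhs r)) ab))
          (trans (+-comm _ 1) (cong suc (length-liftAll-take (rhs r) ab h≤k len)))

  BarII-dot<h : ∀ {r q h pre d} → BarII r q h pre → suc d ≤ h →
    drop (suc d) (proj₂ q) ≢ [ nonterm ⊥ₙ ] → suc d < h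
  BarII-dot<h {r} {h = h} record { ab = ab ; h≤k = h≤k ; len = len ; qEq = refl } sd≤h not⊥
    with m≤n⇒m<n∨m≡n sd≤h
  ... | inj₁ sd<h = sd<h
  ... | inj₂ refl = ⊥-elim (not⊥ (subst (λ n → drop n (body ++ [ nonterm ⊥ₙ ]) ≡ [ nonterm ⊥ₙ ])
                                        (length-liftAll-take (rhs r) ab h≤k len) (drop-length-++ body _)))
    where body = liftAll (take h (rhs r)) ab

  -- The data of a Complete step on x = (r , d , _ , _ , ρ), read off an item (q , d) ∈ x̄
  -- whose next symbol is M.
  Advance : Rule → ℕ → List Φ → IRule → INT → Set
  Advance r d ρ q M = Σ 𝔑 λ N → Σ Φ λ a → Σ Φ λ b →
    M ≡ nt N a b × rhs r !? d ≡ just (inj₁ N) × ρ !? (1 + 2 * d) ≡ just a ×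
    Σ Φ λ z → ParamDefAt r (suc d) (ρ ++ [ b ]) z × Instance r (suc d) (ρ ++ [ b ] ++ [ z ]) q

  BarI-advance : ∀ {r d ρ q M seq} → BarI r q seq → take (2 * suc d) seq ≡ ρ →
    proj₂ q !? d ≡ just (nonterm M) → Advance r d ρ q M
  BarI-advance {r} {d} bI@record { α = α ; β = β ; ab = ab ; seqEq = refl ; inB = inB ; qEq = refl } tk q-d
    with liftAll-!?-nonterm (rhs r) ab q-d
  ... | N , a , b , r-d , ab-d , refl =
    let z , def , tk′ = InB-advance {r} seq inB d<k (s≤s d<k) tk seq-b
    in  N , a , b , refl , r-d , trans (!?-prefix tk (1+2*m<2*n (n<1+n d))) seq-a ,
        z , def , inj₁ (seq , bI , tk′)
    where
      seq = α ∷ flatten ab ++ [ β ]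
      d<k = !?-just⇒< (rhs r) r-d
      seq-a : seq !? (1 + 2 * d) ≡ just a
      seq-a = !?-++ˡ-just (flatten ab) [ β ] (proj₁ (flatten-!? ab ab-d))
      seq-b : seq !? (2 * suc d) ≡ just b
      seq-b = subst (λ n → seq !? n ≡ just b) (sym (2*-suc d))
                    (!?-++ˡ-just (flatten ab) [ β ] (proj₂ (flatten-!? ab ab-d)))

  BarII-advance : ∀ {r d ρ q M h pre} → BarII r q h pre → suc d < h → take (2 * suc d) pre ≡ ρ →
    proj₂ q !? d ≡ just (nonterm M) → Advance r d ρ q M
  BarII-advance {r} {d}
    bII@record { α = α ; ab = ab ; h≤k = h≤k ; len = refl ; preEq = refl ; inB = inB ; qEq = refl } sd<h tk q-d
    with liftAll-!?-nonterm (take (length ab) (rhs r)) ab (!?-++ˡ-just⁻ body [ nonterm ⊥ₙ ] d<|body| q-d)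
    where
      body = liftAll (take (length ab) (rhs r)) ab
      d<|body| = subst (d <_) (sym (length-liftAll-take (rhs r) ab h≤k refl)) (<⇒≤ sd<h)
  ... | N , a , b , r-d , ab-d , refl =
    let z , def , tk′ = InB-advance {r} pre inB d<k sd<h tk pre-b
    in  N , a , b , refl , r-d′ , trans (!?-prefix tk (1+2*m<2*n (n<1+n d))) pre-a ,
        z , def , inj₂ (length ab , pre , bII , sd<h , tk′)
    where
      params = α ∷ flatten ab
      pre = take (2 * length ab) params
      r-d′ = !?-take-just⁻ {h = length ab} (rhs r) r-d
      d<k = !?-just⇒< (rhs r) r-d′
      pre-a : pre !? (1 + 2 * d) ≡ just a
      pre-a = trans (!?-take params (1+2*m<2*n (<⇒≤ sd<h))) (proj₁ (flatten-!? ab ab-d))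
      pre-b : pre !? (2 * suc d) ≡ just b
      pre-b = trans (!?-take params (*-monoʳ-< 2 sd<h))
                    (subst (λ n → params !? n ≡ just b) (sym (2*-suc d)) (proj₂ (flatten-!? ab ab-d)))

  Instance-advance : ∀ {r d ρ q M} → Instance r d ρ q → proj₂ q !? d ≡ just (nonterm M) →
    drop (suc d) (proj₂ q) ≢ [ nonterm ⊥ₙ ] → Advance r d ρ q M
  Instance-advance (inj₁ (_ , bI , tk))             q-d _    = BarI-advance bI tk q-d
  Instance-advance (inj₂ (_ , _ , bII , sd≤h , tk)) q-d not⊥ = BarII-advance bII (BarII-dot<h bII sd≤h not⊥) tk q-d

  Retreat : Rule → ℕ → List Φ → IRule → 𝔑 → Φ → Φ → Set
  Retreat r d ρ q N a b =
    Instance r d ρ q × proj₂ q !? d ≡ just (nonterm (nt N a b)) × drop (suc d) (proj₂ q) ≢ [ nonterm ⊥ₙ ]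

  BarI-retreat : ∀ {r d ρ q seq N a b z} → BarI r q seq → take (2 * suc (suc d)) seq ≡ ρ ++ [ b ] ++ [ z ] →
    length ρ ≡ 2 * suc d → ρ !? (1 + 2 * d) ≡ just a → rhs r !? d ≡ just (inj₁ N) → Retreat r d ρ q N a b
  BarI-retreat {r} {d} {ρ}
    bI@record { α = α ; β = β ; ab = ab ; len = len ; seqEq = refl ; qEq = refl } tk |ρ| ρ-a r-d =
    let tk′ , seq-a , seq-b = params-retreat seq ρ tk |ρ| ρ-a
        ab-d = flatten-!?⁻ ab d<|ab|
                 (!?-++ˡ-just⁻ (flatten ab) [ β ] (subst (2 * d <_) |flatten| (*-monoʳ-< 2 d<|ab|)) seq-a)
                 (!?-++ˡ-just⁻ (flatten ab) [ β ] (subst (1 + 2 * d <_) |flatten| (1+2*m<2*n d<|ab|)) seq-b)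
    in  inj₁ (seq , bI , tk′) , liftAll-!? (rhs r) ab r-d ab-d , drop-liftAll≢[⊥] (suc d) (rhs r) ab
    where
      seq = α ∷ flatten ab ++ [ β ]
      d<|ab| = subst (d <_) (sym len) (!?-just⇒< (rhs r) r-d)
      |flatten| = sym (length-flatten ab)

  BarII-retreat : ∀ {r d ρ q h pre N a b z} → BarII r q h pre → suc (suc d) ≤ h →
    take (2 * suc (suc d)) pre ≡ ρ ++ [ b ] ++ [ z ] →
    length ρ ≡ 2 * suc d → ρ !? (1 + 2 * d) ≡ just a → rhs r !? d ≡ just (inj₁ N) → Retreat r d ρ q N a b
  BarII-retreat {r} {d} {ρ}
    bII@record { α = α ; ab = ab ; h≤k = h≤k ; len = refl ; preEq = refl ; qEq = refl } sd<h tk |ρ| ρ-a r-d =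
    let tk′ , pre-a , pre-b = params-retreat pre ρ tk |ρ| ρ-a
        ab-d = flatten-!?⁻ ab d<h
                 (trans (sym (!?-take params (1+2*m<2*n d<h))) pre-a)
                 (trans (sym (!?-take params (2+2*m<2*n sd<h))) pre-b)
    in  inj₂ (length ab , pre , bII , d<h , tk′) ,
        !?-++ˡ-just body [ nonterm ⊥ₙ ]
          (liftAll-!? (take (length ab) (rhs r)) ab (trans (!?-take (rhs r) d<h) r-d) ab-d) ,
        drop-<-∷ʳ≢[-] body (subst (suc d <_) (sym (length-liftAll-take (rhs r) ab h≤k refl)) sd<h)
    where
      params = α ∷ flatten ab
      pre = take (2 * length ab) params
      body = liftAll (take (length ab) (rhs r)) ab
      d<h = <⇒≤ sd<h

  Instance-retreat : ∀ {r d ρ q N a b z} → Instance r (suc d) (ρ ++ [ b ] ++ [ z ]) q →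
    length ρ ≡ 2 * suc d → ρ !? (1 + 2 * d) ≡ just a → rhs r !? d ≡ just (inj₁ N) → Retreat r d ρ q N a b
  Instance-retreat (inj₁ (_ , bI , tk))              = BarI-retreat bI tk
  Instance-retreat (inj₂ (_ , _ , bII , ssd≤h , tk)) = BarII-retreat bII ssd≤h tk

  complete-BarI : ∀ {r a b ξ} → InB r (suc (length (rhs r))) ξ → ξ !? 0 ≡ just a →
    ξ !? (1 + 2 * length (rhs r)) ≡ just b →
    Σ (List (Φ × Φ)) λ ab → length ab ≡ length (rhs r) × BarI r (nt (lhs r) a b , liftAll (rhs r) ab) ξ
  complete-BarI {r} {ξ = α ∷ rest} inB refl ξ-b
    with unflatten (length (rhs r)) rest (suc-injective (trans (proj₁ inB) (2*-suc (length (rhs r)))))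
  ... | ab , β , len , refl
    with trans (sym ξ-b) (!?-length (flatten ab) β [] (trans (length-flatten ab) (cong (2 *_) len)))
  ... | refl = ab , len , record { α = α ; β = β ; ab = ab ; len = len ; seqEq = refl ; inB = inB ; qEq = refl }

  Instance-complete : ∀ {r N a b w ξ} → Instance r (length w) ξ (nt N a b , w) →
    lhs r ≡ N × length w ≡ length (rhs r) × ξ !? 0 ≡ just a × ξ !? (1 + 2 * length w) ≡ just b
  Instance-complete (inj₂ (_ , _ , bII , |w|<h , _)) =
    ⊥-elim (1+n≰n (≤-trans (n≤1+n _) (subst (λ n → suc n ≤ _) (BarII-length bII) |w|<h)))
  Instance-complete {r}
    (inj₁ (_ , record { α = α ; β = β ; ab = ab ; len = len ; seqEq = refl ; qEq = refl } , refl)) =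
    refl , |w| , refl ,
    trans (!?-take (α ∷ flatten ab ++ [ β ]) (1+2*m<2*n (n<1+n (length (liftAll (rhs r) ab)))))
          (!?-length (flatten ab) β [] (trans (length-flatten ab) (cong (2 *_) (trans len (sym |w|)))))
    where |w| = length-liftAll (rhs r) ab len

  BarSet-Complete⊆Norm-Complete′ : ∀ {n k I I′} → (∀ x → x ∈ I → ValidP n x) →
    BarSet I ⊆ Norm I′ → BarSet (Complete k I) ⊆ Norm (Complete' k I′)
  BarSet-Complete⊆Norm-Complete′ valid bar⊆norm (x , inj₁ x∈I , x̄∋y) = map₁ inj₁ (bar⊆norm (x , x∈I , x̄∋y))
  BarSet-Complete⊆Norm-Complete′ {k = k} valid bar⊆norm {oitem q _ _ _}
    (_ , inj₂ (pitem r d i j ρ , pitem r′ _ _ _ ξ , x₁∈I , x₂∈I , _ , _ , r-d , refl , refl , refl , refl ,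
               (a , ρ-a , ξ-a) , b , ξ-b , z , _ , refl) , refl , refl , refl , inst) =
    let _ , _ , _ , _ , |ρ| , _ = valid _ x₁∈I
        _ , _ , _ , _ , ξ-params = valid _ x₂∈I
        inst₁ , q-d , not⊥ = Instance-retreat inst |ρ| ρ-a r-d
        ab , |ab| , bI₂ = complete-BarI ξ-params ξ-a ξ-b
        ξ̄∋y₂ = inj₁ (ξ , bI₂ , take-all _ ξ (≤-reflexive (proj₁ ξ-params)))
        y₁∈I′ , _ = bar⊆norm (pitem r d i j ρ , x₁∈I , refl , refl , refl , inst₁)
        y₂∈I′ , _ = bar⊆norm (pitem r′ (length (rhs r′)) j k ξ , x₂∈I , refl , refl , refl , ξ̄∋y₂)
    in  inj₂ (oitem q d i j , oitem (nt (lhs r′) a b , liftAll (rhs r′) ab) (length (rhs r′)) j k ,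
              y₁∈I′ , y₂∈I′ , nt (lhs r′) a b , q-d , refl , sym (length-liftAll (rhs r′) ab |ab|) ,
              refl , refl , refl) ,
        Instance⇒lhs≢⊤ inst , not⊥

  Norm-Complete′⊆BarSet-Complete : ∀ {n k I I′} → (∀ y → y ∈ I′ → ValidO n y) →
    Norm I′ ⊆ BarSet I → Norm (Complete' k I′) ⊆ BarSet (Complete k I)
  Norm-Complete′⊆BarSet-Complete valid′ norm⊆bar (inj₁ y∈I′ , not⊤ , not⊥) =
    map₂ (map₁ inj₁) (norm⊆bar (y∈I′ , not⊤ , not⊥))
  Norm-Complete′⊆BarSet-Complete valid′ norm⊆bar
    (inj₂ (oitem (_ , w₁) d i j , oitem (_ , w₂) _ _ _ , y₁∈I′ , y₂∈I′ , _ , w₁-d , refl , refl , refl , refl , refl) ,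
     not⊤ , not⊥)
    with norm⊆bar (y₁∈I′ , not⊤ , λ e →
           InℜBar⇒lhs≢⊥ (proj₁ (valid′ _ y₂∈I′)) (just-nonterm-injective (trans (sym w₁-d) (drop≡∷⇒!? w₁ e))))
  ... | pitem r _ _ _ ρ , x₁∈I , refl , refl , refl , inst₁
    with Instance-advance inst₁ w₁-d not⊥
  ... | N , a , b , refl , r-d , ρ-a , z , def , inst
    with norm⊆bar (y₂∈I′ , (λ ()) , λ e → []≢[-] (trans (sym (drop-all (length w₂) w₂ ≤-refl)) e))
  ... | pitem r′ _ _ _ ξ , x₂∈I , refl , refl , refl , inst₂ =
    let lhs≡N , |w₂| , ξ-a , ξ-b = Instance-complete inst₂
    in  pitem r (suc d) i _ (ρ ++ [ b ] ++ [ z ]) ,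
        inj₂ (pitem r d i j ρ , pitem r′ (length w₂) j _ ξ , x₁∈I , x₂∈I , N , !?-just⇒< (rhs r) r-d , r-d ,
              lhs≡N , |w₂| , refl , refl , (a , ρ-a , ξ-a) , b , ξ-b , z , def , refl) ,
        refl , refl , refl , inst

theorem7 : (G : PLL) → let open Induced G in
    (D : List Alph) (k : ℕ) → k ≤ length D →
    (I : Pred PItem 0ℓ) (I' : Pred OItem 0ℓ) →
    (∀ x → x ∈ I → ValidP (length D) x) →
    (∀ y → y ∈ I' → ValidO (length D) y) →
    I ∼ I' → Complete k I ∼ Complete' k I'
theorem7 G _ _ _ _ _ valid valid′ (bar⊆norm , norm⊆bar) =
  BarSet-Complete⊆Norm-Complete′ G valid bar⊆norm , Norm-Complete′⊆BarSet-Complete G valid′ norm⊆bar
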